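{- Let $\Gamma$ be a quiver whose underlying graph is a Dynkin diagram of type $A$, with vertices drawn from left to right, and let $M=M(\Gamma)$ be its sincere indecomposable representation (one-dimensional at every vertex, identity maps on all arrows). Then \[\det\nabla(M)=1\quad\text{and}\quad \det\Delta(M)=1.\]
   Context: For such $M$, let $\mathfrak{R}(M)$ be the number of submodules of $M$; $\mathfrak{R}_1(M)$ (resp. $\mathfrak{R}_0(M)$) the number of submodules containing (resp. not containing) the rightmost vertex in their support; ${}_0\mathfrak{R}(M)$ the number not containing the leftmost vertex; ${}_0\mathfrak{R}_1(M)$ the number containing the rightmost but not the leftmost vertex; ${}_0\mathfrak{R}_0(M)$ the number containing neither. The specialized rank matrix is $\nabla(M)=\begin{pmatrix}\mathfrak{R}(M)&-\mathfrak{R}_1(M)\\ {}_0\mathfrak{R}(M)&-{}_0\mathfrak{R}_1(M)\end{pmatrix}$ and the dual specialized rank matrix is $\Delta(M)=\begin{pmatrix}\mathfrak{R}_1(M)&\mathfrak{R}_0(M)\\ {}_0\mathfrak{R}_1(M)&{}_0\mathfrak{R}_0(M)\end{pmatrix}$. -}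

module Defs where

open import Data.Bool using (Bool; true; false; not; _∧_; _∨_; T)
open import Data.Bool.Properties using (T?)
open import Data.Nat using (ℕ; zero; suc)
open import Data.Vec using (Vec; []; _∷_; head; last)
open import Data.List using (List; []; _∷_; map; _++_; length; filter)
open import Data.Integer using (ℤ; +_; _-_; _*_; -_)

-- A quiver of Dynkin type A_{m+1}: vertices 0,…,m from left to right,
-- and for each i < m one arrow between i and i+1.
-- Orientation o : Vec Bool m;  o[i] = true  means the arrow is i → i+1,
--                               o[i] = false means the arrow is i+1 → i.
Orientation : ℕ → Set
Orientation m = Vec Bool m

VertexSet : ℕ → Set
VertexSet m = Vec Bool (suc m)

-- A subrepresentation
-- assigns to each vertex either 0 or k, and must be stable under the arrow
-- maps; so subrepresentations correspond exactly to vertex sets S (their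
-- supports) such that for every arrow a : i → j, i ∈ S implies j ∈ S.
isSubmodule : ∀ {m} → Orientation m → VertexSet m → Bool
isSubmodule []          (x ∷ [])     = true
isSubmodule (true  ∷ o) (x ∷ y ∷ s) = (not x ∨ y) ∧ isSubmodule o (y ∷ s)
isSubmodule (false ∷ o) (x ∷ y ∷ s) = (not y ∨ x) ∧ isSubmodule o (y ∷ s)

allVecs : (n : ℕ) → List (Vec Bool n)
allVecs zero    = [] ∷ []
allVecs (suc n) = map (true ∷_) (allVecs n) ++ map (false ∷_) (allVecs n)

submodules : ∀ {m} → Orientation m → List (VertexSet m)
submodules {m} o = filter (λ s → T? (isSubmodule o s)) (allVecs (suc m))

countSub : ∀ {m} → Orientation m → (VertexSet m → Bool) → ℕ
countSub o P = length (filter (λ s → T? (P s)) (submodules o))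

leftIn rightIn : ∀ {m} → VertexSet m → Bool
leftIn  s = head s
rightIn s = last s

R R₁ R₀ ₀R ₀R₁ ₀R₀ : ∀ {m} → Orientation m → ℕ
R   o = countSub o (λ _ → true)
R₁  o = countSub o (λ s → rightIn s)
R₀  o = countSub o (λ s → not (rightIn s))
₀R  o = countSub o (λ s → not (leftIn s))
₀R₁ o = countSub o (λ s → not (leftIn s) ∧ rightIn s)
₀R₀ o = countSub o (λ s → not (leftIn s) ∧ not (rightIn s))

det2 : ℤ → ℤ → ℤ → ℤ → ℤ
det2 a b c d = a * d - b * c

detNabla : ∀ {m} → Orientation m → ℤ
detNabla o = det2 (+ R o) (- (+ R₁ o)) (+ ₀R o) (- (+ ₀R₁ o))

detDelta : ∀ {m} → Orientation m → ℤ
detDelta o = det2 (+ R₁ o) (+ R₀ o) (+ ₀R₁ o) (+ ₀R₀ o)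

{-# OPTIONS --safe #-}

-- Sort the submodules of M(Γ) by whether their support contains the leftmost
-- and the rightmost vertex; the four counts form a 2×2 matrix T(Γ).  Putting a
-- new arrow in front of Γ multiplies T by a unipotent elementary matrix, since
-- the arrow either forces the second vertex into the support when the first
-- is in, or forces it out when the first is out.  Hence det T = 1.  Now Δ(M)
-- is T with its second row added to its first, and ∇(M) arises from Δ(M) by
-- adding the first column to the second (𝔑 = 𝔑₁ + 𝔑₀, ₀𝔑 = ₀𝔑₁ + ₀𝔑₀) and
-- then replacing the columns (u , v) by (v , -u); neither step changes the
-- determinant.

module Submission where

open import Defs
open import Data.Bool using (Bool; true; false; not; _∧_; _∨_)
open import Data.Bool.Properties using (T?; ∧-assoc; ∧-comm)
open import Data.Integer as ℤ using (ℤ; +_; -_)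
open import Data.Integer.Properties using (pos-+)
open import Data.List using (List; []; _∷_; map; _++_; length; filter)
open import Data.Nat using (ℕ; suc)
open import Data.Product using (_×_; _,_)
open import Function using (_∘_)
open import Relation.Binary.PropositionalEquality
  using (_≡_; _≗_; refl; sym; trans; cong; cong₂; module ≡-Reasoning)
open ≡-Reasoning

module Det2Properties where
  open import Data.Integer using (_+_; _*_; _-_)
  open import Data.Integer.Tactic.RingSolver using (solve)

  det2-addLowerRow : ∀ a b c d → det2 (a + c) (b + d) c d ≡ det2 a b c d
  det2-addLowerRow a b c d = begin
    (a + c) * d - (b + d) * c  ≡⟨ solve (a ∷ b ∷ c ∷ d ∷ []) ⟩
    a * d - b * c              ∎

  det2-addUpperRow : ∀ a b c d → det2 a b (a + c) (b + d) ≡ det2 a b c d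
  det2-addUpperRow a b c d = begin
    a * (b + d) - b * (a + c)  ≡⟨ solve (a ∷ b ∷ c ∷ d ∷ []) ⟩
    a * d - b * c              ∎

  det2-addLeftColumn : ∀ a b c d → det2 a (a + b) c (c + d) ≡ det2 a b c d
  det2-addLeftColumn a b c d = begin
    a * (c + d) - (a + b) * c  ≡⟨ solve (a ∷ b ∷ c ∷ d ∷ []) ⟩
    a * d - b * c              ∎

  det2-negate-swapColumns : ∀ a b c d → det2 a (- b) c (- d) ≡ det2 b a d c
  det2-negate-swapColumns a b c d = begin
    a * - d - - b * c  ≡⟨ solve (a ∷ b ∷ c ∷ d ∷ []) ⟩
    b * c - a * d      ∎

open Det2Properties

-- Opened only now: they would clash with the ℤ operators and the solver's
-- list syntax above.
open import Data.Vec using (Vec; []; _∷_; head; last)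
open import Data.Nat using (_+_; _*_)
open import Data.Nat.Properties using (+-assoc; +-commutativeSemigroup)
open import Data.Nat.Tactic.RingSolver using (solve-∀)
open import Algebra.Properties.CommutativeSemigroup +-commutativeSemigroup using (interchange)

private
  variable
    A B : Set
    m n : ℕ

[_] : Bool → ℕ
[ true ]  = 1
[ false ] = 0

count : (A → Bool) → List A → ℕ
count p []       = 0
count p (x ∷ xs) = [ p x ] + count p xs

length-filter : (p : A → Bool) (xs : List A) → length (filter (T? ∘ p) xs) ≡ count p xs
length-filter p []       = refl
length-filter p (x ∷ xs) with p x
... | true  = cong suc (length-filter p xs)
... | false = length-filter p xs

_∧′_ : (A → Bool) → (A → Bool) → A → Bool
(p ∧′ q) x = p x ∧ q x

count-filter : (p q : A → Bool) (xs : List A) → count q (filter (T? ∘ p) xs) ≡ count (p ∧′ q) xs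
count-filter p q []       = refl
count-filter p q (x ∷ xs) with p x
... | true  = cong (_+_ [ q x ]) (count-filter p q xs)
... | false = count-filter p q xs

count-++ : (p : A → Bool) (xs ys : List A) → count p (xs ++ ys) ≡ count p xs + count p ys
count-++ p []       ys = refl
count-++ p (x ∷ xs) ys =
  trans (cong (_+_ [ p x ]) (count-++ p xs ys)) (sym (+-assoc [ p x ] (count p xs) (count p ys)))

count-map : (p : B → Bool) (f : A → B) (xs : List A) → count p (map f xs) ≡ count (p ∘ f) xs
count-map p f []       = refl
count-map p f (x ∷ xs) = cong (_+_ [ p (f x) ]) (count-map p f xs)

count-cong : {p q : A → Bool} → p ≗ q → (xs : List A) → count p xs ≡ count q xs
count-cong p≗q []       = refl
count-cong p≗q (x ∷ xs) = cong₂ _+_ (cong [_] (p≗q x)) (count-cong p≗q xs)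

count-+ : {p q r : A → Bool} → (∀ x → [ p x ] ≡ [ q x ] + [ r x ]) →
          (xs : List A) → count p xs ≡ count q xs + count r xs
count-+ split []       = refl
count-+ {p = p} {q} {r} split (x ∷ xs) = begin
  [ p x ] + count p xs                            ≡⟨ cong₂ _+_ (split x) (count-+ split xs) ⟩
  ([ q x ] + [ r x ]) + (count q xs + count r xs) ≡⟨ interchange [ q x ] [ r x ] _ _ ⟩
  count q (x ∷ xs) + count r (x ∷ xs)             ∎

[]-split : ∀ b c → [ b ] ≡ [ b ∧ c ] + [ b ∧ not c ]
[]-split true  true  = refl
[]-split true  false = refl
[]-split false c     = refl

countSub≡count : (o : Orientation m) (P : VertexSet m → Bool) →
                 countSub o P ≡ count (isSubmodule o ∧′ P) (allVecs (suc m))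
countSub≡count {m} o P =
  trans (length-filter P (submodules o)) (count-filter (isSubmodule o) P (allVecs (suc m)))

countSub-split : (o : Orientation m) (P Q : VertexSet m → Bool) →
                 countSub o P ≡ countSub o (P ∧′ Q) + countSub o (P ∧′ (not ∘ Q))
countSub-split {m} o P Q = begin
  countSub o P
    ≡⟨ countSub≡count o P ⟩
  count (isSubmodule o ∧′ P) (allVecs (suc m))
    ≡⟨ count-+ split (allVecs (suc m)) ⟩
  count (isSubmodule o ∧′ (P ∧′ Q)) (allVecs (suc m))
    + count (isSubmodule o ∧′ (P ∧′ (not ∘ Q))) (allVecs (suc m))
    ≡⟨ sym (cong₂ _+_ (countSub≡count o (P ∧′ Q)) (countSub≡count o (P ∧′ (not ∘ Q)))) ⟩
  countSub o (P ∧′ Q) + countSub o (P ∧′ (not ∘ Q)) ∎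
  where
  split : ∀ s → [ isSubmodule o s ∧ P s ] ≡
                [ isSubmodule o s ∧ (P s ∧ Q s) ] + [ isSubmodule o s ∧ (P s ∧ not (Q s)) ]
  split s = trans ([]-split (isSubmodule o s ∧ P s) (Q s))
                  (cong₂ _+_ (cong [_] (∧-assoc (isSubmodule o s) (P s) (Q s)))
                              (cong [_] (∧-assoc (isSubmodule o s) (P s) (not (Q s)))))

count-allVecs : (p : Vec Bool (suc n) → Bool) →
                count p (allVecs (suc n))
                ≡ count (p ∘ (true ∷_)) (allVecs n) + count (p ∘ (false ∷_)) (allVecs n)
count-allVecs {n} p =
  trans (count-++ p (map (true ∷_) (allVecs n)) (map (false ∷_) (allVecs n)))
        (cong₂ _+_ (count-map p (true ∷_) (allVecs n)) (count-map p (false ∷_) (allVecs n)))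

closedAlong : Bool → Bool → Bool → Bool
closedAlong true  x y = not x ∨ y
closedAlong false x y = not y ∨ x

isSubmodule-∷ : ∀ b (o : Orientation m) x (s : VertexSet m) →
                isSubmodule (b ∷ o) (x ∷ s) ≡ closedAlong b x (head s) ∧ isSubmodule o s
isSubmodule-∷ true  o x (y ∷ s) = refl
isSubmodule-∷ false o x (y ∷ s) = refl

countByEnds : Orientation m → (Bool → Bool → Bool) → ℕ
countByEnds o g = countSub o (λ s → g (leftIn s) (rightIn s))

countByEnds-∷ : ∀ b (o : Orientation m) g →
                countByEnds (b ∷ o) g ≡ countByEnds o (λ z y → closedAlong b true z ∧ g true y)
                                      + countByEnds o (λ z y → closedAlong b false z ∧ g false y)
countByEnds-∷ {m} b o g = begin
  countByEnds (b ∷ o) g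
    ≡⟨ countSub≡count (b ∷ o) (λ s → g (head s) (last s)) ⟩
  count (λ s → isSubmodule (b ∷ o) s ∧ g (head s) (last s)) (allVecs (suc (suc m)))
    ≡⟨ count-allVecs (λ s → isSubmodule (b ∷ o) s ∧ g (head s) (last s)) ⟩
  count (λ s → isSubmodule (b ∷ o) (true ∷ s) ∧ g true (last s)) (allVecs (suc m))
    + count (λ s → isSubmodule (b ∷ o) (false ∷ s) ∧ g false (last s)) (allVecs (suc m))
    ≡⟨ cong₂ _+_ (count-cong (dropLeftmost true) (allVecs (suc m)))
                 (count-cong (dropLeftmost false) (allVecs (suc m))) ⟩
  count (isSubmodule o ∧′ endsWith true) (allVecs (suc m))
    + count (isSubmodule o ∧′ endsWith false) (allVecs (suc m))
    ≡⟨ sym (cong₂ _+_ (countSub≡count o (endsWith true)) (countSub≡count o (endsWith false))) ⟩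
  countByEnds o (λ z y → closedAlong b true z ∧ g true y)
    + countByEnds o (λ z y → closedAlong b false z ∧ g false y) ∎
  where
  endsWith : Bool → VertexSet m → Bool
  endsWith x s = closedAlong b x (head s) ∧ g x (last s)

  dropLeftmost : ∀ x (s : VertexSet m) →
                 isSubmodule (b ∷ o) (x ∷ s) ∧ g x (last s) ≡ isSubmodule o s ∧ endsWith x s
  dropLeftmost x s = begin
    isSubmodule (b ∷ o) (x ∷ s) ∧ g x (last s)
      ≡⟨ cong (_∧ g x (last s)) (trans (isSubmodule-∷ b o x s) (∧-comm _ (isSubmodule o s))) ⟩
    (isSubmodule o s ∧ closedAlong b x (head s)) ∧ g x (last s)
      ≡⟨ ∧-assoc (isSubmodule o s) _ _ ⟩
    isSubmodule o s ∧ (closedAlong b x (head s) ∧ g x (last s)) ∎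

Mat : Set
Mat = Bool → Bool → ℕ

extendLeft : Bool → Mat → Mat
extendLeft true  M true  y = M true y
extendLeft true  M false y = M true y + M false y
extendLeft false M true  y = M true y + M false y
extendLeft false M false y = M false y

-- By countByEnds≡sumWhere, endMatrix o x y is the number of submodules whose
-- support contains the leftmost vertex iff x and the rightmost vertex iff y.
endMatrix : Orientation m → Mat
endMatrix []      true  y = [ y ]
endMatrix []      false y = [ not y ]
endMatrix (b ∷ o)         = extendLeft b (endMatrix o)

sumWhere : (Bool → Bool → Bool) → Mat → ℕ
sumWhere g M = [ g true  true ] * M true  true + [ g true  false ] * M true  false
             + [ g false true ] * M false true + [ g false false ] * M false false

sumWhere-extendLeft : ∀ b g M →
  sumWhere (λ z y → closedAlong b true z ∧ g true y) M
    + sumWhere (λ z y → closedAlong b false z ∧ g false y) M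
  ≡ sumWhere g (extendLeft b M)
sumWhere-extendLeft true g M =
  identity [ g true true ] [ g true false ] [ g false true ] [ g false false ]
           (M true true) (M true false) (M false true) (M false false)
  where
  identity : ∀ p q r s a b c d →
    (p * a + q * b + 0 * c + 0 * d) + (r * a + s * b + r * c + s * d)
    ≡ p * a + q * b + r * (a + c) + s * (b + d)
  identity = solve-∀
sumWhere-extendLeft false g M =
  identity [ g true true ] [ g true false ] [ g false true ] [ g false false ]
           (M true true) (M true false) (M false true) (M false false)
  where
  identity : ∀ p q r s a b c d →
    (p * a + q * b + p * c + q * d) + (0 * a + 0 * b + r * c + s * d)
    ≡ p * (a + c) + q * (b + d) + r * c + s * d
  identity = solve-∀

countByEnds≡sumWhere : (o : Orientation m) (g : Bool → Bool → Bool) →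
                       countByEnds o g ≡ sumWhere g (endMatrix o)
countByEnds≡sumWhere [] g =
  trans (countSub≡count [] (λ s → g (head s) (last s)))
        (identity [ g true true ] [ g true false ] [ g false true ] [ g false false ])
  where
  identity : ∀ p q r s → p + (s + 0) ≡ p * 1 + q * 0 + r * 0 + s * 1
  identity = solve-∀
countByEnds≡sumWhere (b ∷ o) g = begin
  countByEnds (b ∷ o) g
    ≡⟨ countByEnds-∷ b o g ⟩
  countByEnds o g₁ + countByEnds o g₂
    ≡⟨ cong₂ _+_ (countByEnds≡sumWhere o g₁) (countByEnds≡sumWhere o g₂) ⟩
  sumWhere g₁ (endMatrix o) + sumWhere g₂ (endMatrix o)
    ≡⟨ sumWhere-extendLeft b g (endMatrix o) ⟩
  sumWhere g (endMatrix (b ∷ o)) ∎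
  where
  g₁ g₂ : Bool → Bool → Bool
  g₁ z y = closedAlong b true z ∧ g true y
  g₂ z y = closedAlong b false z ∧ g false y

det : Mat → ℤ
det M = det2 (+ M true true) (+ M true false) (+ M false true) (+ M false false)

det-extendLeft : ∀ b M → det (extendLeft b M) ≡ det M
det-extendLeft true M = begin
  det2 (+ a) (+ b) (+ (a + c)) (+ (b + d))
    ≡⟨ cong₂ (det2 (+ a) (+ b)) (pos-+ a c) (pos-+ b d) ⟩
  det2 (+ a) (+ b) (+ a ℤ.+ + c) (+ b ℤ.+ + d)
    ≡⟨ det2-addUpperRow (+ a) (+ b) (+ c) (+ d) ⟩
  det M ∎
  where a = M true true; b = M true false; c = M false true; d = M false false
det-extendLeft false M = begin
  det2 (+ (a + c)) (+ (b + d)) (+ c) (+ d)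
    ≡⟨ cong₂ (λ u v → det2 u v (+ c) (+ d)) (pos-+ a c) (pos-+ b d) ⟩
  det2 (+ a ℤ.+ + c) (+ b ℤ.+ + d) (+ c) (+ d)
    ≡⟨ det2-addLowerRow (+ a) (+ b) (+ c) (+ d) ⟩
  det M ∎
  where a = M true true; b = M true false; c = M false true; d = M false false

det-endMatrix : (o : Orientation m) → det (endMatrix o) ≡ + 1
det-endMatrix []      = refl
det-endMatrix (b ∷ o) = trans (det-extendLeft b (endMatrix o)) (det-endMatrix o)

detDelta≡det-endMatrix : (o : Orientation m) → detDelta o ≡ det (endMatrix o)
detDelta≡det-endMatrix o = begin
  det2 (+ R₁ o) (+ R₀ o) (+ ₀R₁ o) (+ ₀R₀ o)
    ≡⟨ cong₂ (λ u v → det2 u v (+ ₀R₁ o) (+ ₀R₀ o)) R₁≡ R₀≡ ⟩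
  det2 (+ a ℤ.+ + c) (+ b ℤ.+ + d) (+ ₀R₁ o) (+ ₀R₀ o)
    ≡⟨ cong₂ (det2 (+ a ℤ.+ + c) (+ b ℤ.+ + d)) (cong +_ ₀R₁≡) (cong +_ ₀R₀≡) ⟩
  det2 (+ a ℤ.+ + c) (+ b ℤ.+ + d) (+ c) (+ d)
    ≡⟨ det2-addLowerRow (+ a) (+ b) (+ c) (+ d) ⟩
  det (endMatrix o) ∎
  where
  a = endMatrix o true true;  b = endMatrix o true false
  c = endMatrix o false true; d = endMatrix o false false
  R₁≡ : + R₁ o ≡ + a ℤ.+ + c
  R₁≡ = trans (cong +_ (trans (countByEnds≡sumWhere o (λ _ y → y)) (identity a b c d)))
              (pos-+ a c)
    where identity : ∀ a b c d → 1 * a + 0 * b + 1 * c + 0 * d ≡ a + c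
          identity = solve-∀
  R₀≡ : + R₀ o ≡ + b ℤ.+ + d
  R₀≡ = trans (cong +_ (trans (countByEnds≡sumWhere o (λ _ y → not y)) (identity a b c d)))
              (pos-+ b d)
    where identity : ∀ a b c d → 0 * a + 1 * b + 0 * c + 1 * d ≡ b + d
          identity = solve-∀
  ₀R₁≡ : ₀R₁ o ≡ c
  ₀R₁≡ = trans (countByEnds≡sumWhere o (λ x y → not x ∧ y)) (identity a b c d)
    where identity : ∀ a b c d → 0 * a + 0 * b + 1 * c + 0 * d ≡ c
          identity = solve-∀
  ₀R₀≡ : ₀R₀ o ≡ d
  ₀R₀≡ = trans (countByEnds≡sumWhere o (λ x y → not x ∧ not y)) (identity a b c d)
    where identity : ∀ a b c d → 0 * a + 0 * b + 0 * c + 1 * d ≡ d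
          identity = solve-∀

detNabla≡detDelta : (o : Orientation m) → detNabla o ≡ detDelta o
detNabla≡detDelta o = begin
  det2 (+ R o) (- + R₁ o) (+ ₀R o) (- + ₀R₁ o)
    ≡⟨ det2-negate-swapColumns (+ R o) (+ R₁ o) (+ ₀R o) (+ ₀R₁ o) ⟩
  det2 (+ R₁ o) (+ R o) (+ ₀R₁ o) (+ ₀R o)
    ≡⟨ cong₂ (λ u v → det2 (+ R₁ o) u (+ ₀R₁ o) v)
             (castSplit (λ _ → true)) (castSplit (not ∘ leftIn)) ⟩
  det2 (+ R₁ o) (+ R₁ o ℤ.+ + R₀ o) (+ ₀R₁ o) (+ ₀R₁ o ℤ.+ + ₀R₀ o)
    ≡⟨ det2-addLeftColumn (+ R₁ o) (+ R₀ o) (+ ₀R₁ o) (+ ₀R₀ o) ⟩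
  detDelta o ∎
  where
  castSplit : ∀ P → + countSub o P
                    ≡ + countSub o (P ∧′ rightIn) ℤ.+ + countSub o (P ∧′ (not ∘ rightIn))
  castSplit P = trans (cong +_ (countSub-split o P rightIn))
                      (pos-+ (countSub o (P ∧′ rightIn)) (countSub o (P ∧′ (not ∘ rightIn))))

corollary4p18 : (m : ℕ) (o : Orientation m) → (detNabla o ≡ + 1) × (detDelta o ≡ + 1)
corollary4p18 m o = trans (detNabla≡detDelta o) detDelta≡1 , detDelta≡1
  where
  detDelta≡1 : detDelta o ≡ + 1
  detDelta≡1 = trans (detDelta≡det-endMatrix o) (det-endMatrix o)
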